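{- For all integers $k\ge2$ and $m,n\ge0$, $N_k(m,n)\ge N_k(m+2,n)$.
   Context: $(a;q)_n=\prod_{0\le j<n}(1-aq^j)$ and $(a,b;q)_n=(a;q)_n(b;q)_n$. For $k\ge2$ the Garvan $k$-rank counts $N_k(m,n)$ are defined by the formal expansion (power series in $q$ with Laurent polynomial coefficients in $x$) $$\sum_{n\ge0}\sum_{m\in\mathbb{Z}}N_k(m,n)x^mq^n=\sum_{n_{k-1}\ge n_{k-2}\ge\cdots\ge n_1\ge0}\frac{q^{n_1^2+n_2^2+\cdots+n_{k-1}^2}}{(q;q)_{n_{k-1}-n_{k-2}}\cdots(q;q)_{n_2-n_1}(xq,x^{ -1}q;q)_{n_1}}.$$ -}

module Defs where

open import Data.Nat as ℕ using (ℕ; zero; suc; _∸_; _%_; _/_)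
open import Data.Integer as ℤ using (ℤ; +_; _-_)
open import Data.List using (List; []; _∷_; map; concatMap; upTo; foldr)
open import Data.Bool using (Bool; true; false; if_then_else_; _∧_)
open import Relation.Nullary.Decidable using (⌊_⌋)

-- Formal power series in q whose coefficients are Laurent polynomials in x:
-- s n m = coefficient of x^m q^n.
Series : Set
Series = ℕ → ℤ → ℤ

-- Every series built below has the property that the coefficient of q^n
-- is supported on exponents m with |m| ≤ n (each x^{±1} comes with a q).
-- The product uses this to make the inner (Laurent) convolution finite.

sumℤ : List ℤ → ℤ
sumℤ = foldr ℤ._+_ (+ 0)

window : ℕ → List ℤ
window a = map (λ i → + i - + a) (upTo (suc (a ℕ.+ a)))

_·_ : Series → Series → Series
(f · g) n m =
  sumℤ (map (λ a → sumℤ (map (λ b → f a b ℤ.* g (n ∸ a) (m - b)) (window a)))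
            (upTo (suc n)))

infixl 7 _·_

one : Series
one n m = if ⌊ n ℕ.≟ 0 ⌋ ∧ ⌊ m ℤ.≟ + 0 ⌋ then + 1 else + 0

qpow : ℕ → Series
qpow s n m = if ⌊ n ℕ.≟ s ⌋ ∧ ⌊ m ℤ.≟ + 0 ⌋ then + 1 else + 0

-- 1 / (1 - x^e q^(suc j)) = Σ_r x^(e r) q^((suc j) r)
invFactor : ℤ → ℕ → Series
invFactor e j n m =
  if ⌊ n % suc j ℕ.≟ 0 ⌋ ∧ ⌊ m ℤ.≟ e ℤ.* + (n / suc j) ⌋ then + 1 else + 0

-- 1 / (x^e q; q)_j = Π_{0 ≤ i < j} 1/(1 - x^e q^(i+1))
invPoch : ℤ → ℕ → Series
invPoch e zero    = one
invPoch e (suc j) = invPoch e j · invFactor e j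

-- The summand for the chain n_{k-1} ≥ … ≥ n_1, given as the list
-- [n_{k-1}, n_{k-2}, …, n_1]:
--   q^{n_1²+…+n_{k-1}²} / ((q;q)_{n_{k-1}-n_{k-2}} ⋯ (q;q)_{n_2-n_1} (xq, x⁻¹q; q)_{n_1})
term : List ℕ → Series
term []            = one
term (a ∷ [])      = qpow (a ℕ.* a) · invPoch (+ 1) a · invPoch (ℤ.- + 1) a
term (a ∷ b ∷ ns)  = qpow (a ℕ.* a) · invPoch (+ 0) (a ∸ b) · term (b ∷ ns)

chains : ℕ → ℕ → List (List ℕ)
chains zero    B = [] ∷ []
chains (suc L) B = concatMap (λ t → map (t ∷_) (chains L t)) (upTo (suc B))

-- Only chains with n_{k-1} ≤ n can contribute to q^n (the summand is
-- q^{n_{k-1}²}·(power series in q)), so the sum is truncated there.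
N : ℕ → ℤ → ℕ → ℤ
N k m n = sumℤ (map (λ ns → term ns n m) (chains (k ∸ 1) n))

{-# OPTIONS --safe #-}

-- The inequality holds for every summand of the generating function separately.
-- Let symGeo j be multiplication by 1/((1 - xq^(j+1))(1 - x⁻¹q^(j+1))). The summand
-- q^(a²)/(xq, x⁻¹q; q)_a of a one-element chain is q^(a²) multiplied by symGeo 0, …, symGeo (a-1),
-- and symGeo preserves the property of being symmetric under x ↦ x⁻¹ with the coefficients of
-- x^m, x^(m+2), x^(m+4), … decreasing for m ≥ 0: after cancelling a common part, the change from
-- x^m to x^(m+2) is a sum of differences f(m+2+t) − f(m−t) ≤ 0. A longer chain multiplies the
-- summand of its tail by a series in q alone with nonnegative coefficients, which keeps the
-- coefficients decreasing.

module Submission where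

open import Defs
open import Data.Nat using (ℕ; _≥_)
open import Data.Integer using (+_; _+_) renaming (_≥_ to _≥ℤ_)
open import Data.Nat as ℕ using (zero; suc; _∸_; z≤n; s≤s; _≤_; _<_; _≤?_; _<?_; _≟_)
import Data.Nat.Properties as ℕP
import Data.Nat.Tactic.RingSolver as ℕ-Ring
open import Data.Nat.DivMod using (_%_; _/_; m/n≤m; m*n/n≡m; m*n%n≡0; m/n*n≡m)
open import Data.Nat.Divisibility using (m%n≡0⇒n∣m)
open import Data.Integer as ℤ using (ℤ; _-_; _*_; -_; ∣_∣; -[1+_]; +[1+_]; +≤+)
  renaming (_≤_ to _≤ℤ_; _≟_ to _≟ℤ_)
import Data.Integer.Properties as ℤP
open import Data.Integer.Tactic.RingSolver using (solve-∀)
open import Data.Bool using (true; false; if_then_else_)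
open import Data.List using ([]; _∷_; map; upTo; applyUpTo)
import Data.List.Properties as ListP
open import Data.Product using (∃; _×_; _,_; proj₂)
open import Data.Sum using (inj₁; inj₂)
open import Function using (_∘_)
open import Relation.Nullary using (Dec; yes; no; ¬_; contradiction)
open import Relation.Binary.PropositionalEquality

x-y+y≡x : ∀ x y → x - y + y ≡ x
x-y+y≡x = solve-∀

x-y-z≡x-z-y : ∀ x y z → x - y - z ≡ x - z - y
x-y-z≡x-z-y = solve-∀

when : {A : Set} → Dec A → ℤ → ℤ
when (yes _) x = x
when (no _)  _ = + 0

when-yes : {A : Set} (d : Dec A) {x : ℤ} → A → when d x ≡ x
when-yes (yes _) _ = refl
when-yes (no ¬a) a = contradiction a ¬a

when-no : {A : Set} (d : Dec A) {x : ℤ} → ¬ A → when d x ≡ + 0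
when-no (yes a) ¬a = contradiction a ¬a
when-no (no _)  _  = refl

≡when : {A : Set} (d : Dec A) {x y : ℤ} → (A → x ≡ y) → (¬ A → x ≡ + 0) → x ≡ when d y
≡when (yes a) x≡y _   = x≡y a
≡when (no ¬a) _   x≡0 = x≡0 ¬a

when-cong : {A : Set} (d : Dec A) {x y : ℤ} → (A → x ≡ y) → when d x ≡ when d y
when-cong (yes a) x≡y = x≡y a
when-cong (no _)  _   = refl

when-mono-≤ : {A : Set} (d : Dec A) {x y : ℤ} → (A → x ≤ℤ y) → when d x ≤ℤ when d y
when-mono-≤ (yes a) x≤y = x≤y a
when-mono-≤ (no _)  _   = ℤP.≤-refl

*-when : {A : Set} (d : Dec A) (c x : ℤ) → c * when d x ≡ when d (c * x)
*-when (yes _) c x = refl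
*-when (no _)  c x = ℤP.*-zeroʳ c

when-≤-∸ : ∀ k l n x → when (k ≤? n) (when (l ≤? n ∸ k) x) ≡ when (k ℕ.+ l ≤? n) x
when-≤-∸ k l n x with k ≤? n | l ≤? n ∸ k | k ℕ.+ l ≤? n
... | yes _   | yes _     | yes _     = refl
... | yes _   | no _      | no _      = refl
... | no _    | _         | no _      = refl
... | yes k≤n | yes l≤n∸k | no k+l≰n  =
  contradiction (subst (_≤ n) (ℕP.+-comm l k) (ℕP.m≤o∸n⇒m+n≤o l k≤n l≤n∸k)) k+l≰n
... | yes _   | no l≰n∸k  | yes k+l≤n =
  contradiction (ℕP.m+n≤o⇒m≤o∸n l (subst (_≤ n) (ℕP.+-comm k l) k+l≤n)) l≰n∸k
... | no k≰n  | _         | yes k+l≤n = contradiction (ℕP.m+n≤o⇒m≤o k k+l≤n) k≰n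

-- Opaque, so that Agda can recover the summand of ∑[ i < N ] … from a goal by unification.
opaque
  ∑< : ℕ → (ℕ → ℤ) → ℤ
  ∑< N f = sumℤ (applyUpTo f N)

infixr 10 ∑<
syntax ∑< N (λ i → e) = ∑[ i < N ] e

opaque
  unfolding ∑<

  sum-upTo : ∀ (f : ℕ → ℤ) N → sumℤ (map f (upTo N)) ≡ ∑< N f
  sum-upTo f N = cong sumℤ (ListP.map-applyUpTo (λ i → i) f N)

  ∑-cong : ∀ N {f g : ℕ → ℤ} → (∀ i → i < N → f i ≡ g i) → ∑< N f ≡ ∑< N g
  ∑-cong zero    f≡g = refl
  ∑-cong (suc N) f≡g = cong₂ _+_ (f≡g 0 ℕ.z<s) (∑-cong N (λ i i<N → f≡g (suc i) (s≤s i<N)))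

  ∑-zero : ∀ N {f : ℕ → ℤ} → (∀ i → i < N → f i ≡ + 0) → ∑< N f ≡ + 0
  ∑-zero N f≡0 = trans (∑-cong N f≡0) (∑-0 N)
    where
    ∑-0 : ∀ N → ∑[ i < N ] (+ 0) ≡ + 0
    ∑-0 zero    = refl
    ∑-0 (suc N) = trans (ℤP.+-identityˡ _) (∑-0 N)

  ∑-snoc : ∀ N (f : ℕ → ℤ) → ∑< (suc N) f ≡ ∑< N f + f N
  ∑-snoc zero    f = ℤP.+-comm (f 0) (+ 0)
  ∑-snoc (suc N) f = trans (cong (_+_ (f 0)) (∑-snoc N (f ∘ suc))) (sym (ℤP.+-assoc (f 0) _ _))

  ∑-distrib-+ : ∀ N (f g : ℕ → ℤ) → ∑[ i < N ] (f i + g i) ≡ ∑< N f + ∑< N g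
  ∑-distrib-+ zero    f g = refl
  ∑-distrib-+ (suc N) f g =
    trans (cong (_+_ (f 0 + g 0)) (∑-distrib-+ N (f ∘ suc) (g ∘ suc))) (interchange (f 0) (g 0) _ _)
    where
    interchange : ∀ a b c d → a + b + (c + d) ≡ a + c + (b + d)
    interchange = solve-∀

  *-distribˡ-∑ : ∀ N (c : ℤ) (f : ℕ → ℤ) → c * ∑< N f ≡ ∑[ i < N ] (c * f i)
  *-distribˡ-∑ zero    c f = ℤP.*-zeroʳ c
  *-distribˡ-∑ (suc N) c f =
    trans (ℤP.*-distribˡ-+ c (f 0) _) (cong (_+_ (c * f 0)) (*-distribˡ-∑ N c (f ∘ suc)))

  ∑-comm : ∀ M N (f : ℕ → ℕ → ℤ) → ∑[ i < M ] ∑[ j < N ] f i j ≡ ∑[ j < N ] ∑[ i < M ] f i j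
  ∑-comm zero    N f = sym (∑-zero N (λ _ _ → refl))
  ∑-comm (suc M) N f = begin
    ∑[ j < N ] f 0 j + ∑[ i < M ] ∑[ j < N ] f (suc i) j
      ≡⟨ cong (_+_ (∑[ j < N ] f 0 j)) (∑-comm M N (f ∘ suc)) ⟩
    ∑[ j < N ] f 0 j + ∑[ j < N ] ∑[ i < M ] f (suc i) j
      ≡⟨ ∑-distrib-+ N (f 0) _ ⟨
    ∑[ j < N ] (f 0 j + ∑[ i < M ] f (suc i) j)
      ∎
    where open ≡-Reasoning

  ∑-mono-≤ : ∀ N {f g : ℕ → ℤ} → (∀ i → i < N → f i ≤ℤ g i) → ∑< N f ≤ℤ ∑< N g
  ∑-mono-≤ zero    f≤g = ℤP.≤-refl
  ∑-mono-≤ (suc N) f≤g = ℤP.+-mono-≤ (f≤g 0 ℕ.z<s) (∑-mono-≤ N (λ i i<N → f≤g (suc i) (s≤s i<N)))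

  ∑-nonneg : ∀ N {f : ℕ → ℤ} → (∀ i → + 0 ≤ℤ f i) → + 0 ≤ℤ ∑< N f
  ∑-nonneg N {f} 0≤f = subst (_≤ℤ ∑< N f) (∑-zero N (λ _ _ → refl)) (∑-mono-≤ N (λ i _ → 0≤f i))

  ∑-extend : ∀ {M} N (f : ℕ → ℤ) → M ≤ N → (∀ i → M ≤ i → i < N → f i ≡ + 0) → ∑< N f ≡ ∑< M f
  ∑-extend zero    f z≤n _ = refl
  ∑-extend {M} (suc N) f M≤1+N f≡0 with M ≟ suc N
  ... | yes refl = refl
  ... | no M≢1+N = begin
    ∑< (suc N) f  ≡⟨ ∑-snoc N f ⟩
    ∑< N f + f N  ≡⟨ cong (_+_ (∑< N f)) (f≡0 N M≤N ℕP.≤-refl) ⟩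
    ∑< N f + + 0  ≡⟨ ℤP.+-identityʳ _ ⟩
    ∑< N f        ≡⟨ ∑-extend N f M≤N (λ i M≤i i<N → f≡0 i M≤i (ℕP.m<n⇒m<1+n i<N)) ⟩
    ∑< M f        ∎
    where
    open ≡-Reasoning
    M≤N : M ≤ N
    M≤N = ℕP.≤-pred (ℕP.≤∧≢⇒< M≤1+N M≢1+N)

  ∑-delta : ∀ N k {f : ℕ → ℤ} → k < N → (∀ i → i < N → i ≢ k → f i ≡ + 0) → ∑< N f ≡ f k
  ∑-delta (suc N) zero    {f} _ f≡0 =
    trans (cong (_+_ (f 0)) (∑-zero N (λ i i<N → f≡0 (suc i) (s≤s i<N) (λ ())))) (ℤP.+-identityʳ (f 0))
  ∑-delta (suc N) (suc k) {f} (s≤s k<N) f≡0 =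
    trans (cong (_+ ∑< N (f ∘ suc)) (f≡0 0 ℕ.z<s (λ ())))
          (trans (ℤP.+-identityˡ _) (∑-delta N k k<N (λ i i<N i≢k →
            f≡0 (suc i) (s≤s i<N) (i≢k ∘ ℕP.suc-injective))))

  ∑-suc : ∀ N (f : ℕ → ℤ) → ∑< (suc N) f ≡ f 0 + ∑[ i < N ] f (suc i)
  ∑-suc N f = refl

∑-when : ∀ {A : Set} (d : Dec A) N (f : ℕ → ℤ) → ∑[ i < N ] when d (f i) ≡ when d (∑< N f)
∑-when (yes _) N f = refl
∑-when (no _)  N f = ∑-zero N (λ _ _ → refl)

∸-swap : ∀ n a k → n ∸ a ∸ k ≡ n ∸ k ∸ a
∸-swap n a k = trans (ℕP.∸-+-assoc n a k) (trans (cong (n ∸_) (ℕP.+-comm a k)) (sym (ℕP.∸-+-assoc n k a)))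

∸-≤-swap : ∀ {n a k} → a ≤ n → k ≤ n ∸ a → a ≤ n ∸ k
∸-≤-swap {n} {a} {k} a≤n k≤n∸a =
  ℕP.m+n≤o⇒m≤o∸n a (subst (_≤ n) (ℕP.+-comm k a) (ℕP.m≤o∸n⇒m+n≤o k a≤n k≤n∸a))

∑-multiples : ∀ j d N (H : ℕ → ℤ) → d < N →
              ∑[ r < N ] when (suc j ℕ.* r ≟ d) (H r) ≡ when (d % suc j ≟ 0) (H (d / suc j))
∑-multiples j d N H d<N with d % suc j ≟ 0
... | yes c∣d = trans (∑-delta N (d / suc j) (ℕP.≤-<-trans (m/n≤m d (suc j)) d<N) off)
                      (when-yes (suc j ℕ.* (d / suc j) ≟ d) c*[d/c]≡d)
  where
  c*[d/c]≡d : suc j ℕ.* (d / suc j) ≡ d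
  c*[d/c]≡d = trans (ℕP.*-comm (suc j) (d / suc j)) (m/n*n≡m (m%n≡0⇒n∣m d (suc j) c∣d))
  off : ∀ r → r < N → r ≢ d / suc j → when (suc j ℕ.* r ≟ d) (H r) ≡ + 0
  off r _ r≢d/c = when-no (suc j ℕ.* r ≟ d) (λ c*r≡d → r≢d/c (begin
    r                      ≡⟨ m*n/n≡m r (suc j) ⟨
    r ℕ.* suc j / suc j    ≡⟨ cong (_/ suc j) (trans (ℕP.*-comm r (suc j)) c*r≡d) ⟩
    d / suc j              ∎))
    where open ≡-Reasoning
... | no c∤d = ∑-zero N (λ r _ → when-no (suc j ℕ.* r ≟ d) (λ c*r≡d →
                 c∤d (trans (cong (_% suc j) (trans (sym c*r≡d) (ℕP.*-comm (suc j) r))) (m*n%n≡0 r (suc j)))))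

∑-complement : ∀ n k (H : ℕ → ℤ) → ∑[ a < suc n ] when (k ≟ n ∸ a) (H a) ≡ when (k ≤? n) (H (n ∸ k))
∑-complement n k H with k ≤? n
... | yes k≤n = trans (∑-delta (suc n) (n ∸ k) (s≤s (ℕP.m∸n≤m n k)) off)
                      (when-yes (k ≟ n ∸ (n ∸ k)) (sym (ℕP.m∸[m∸n]≡n k≤n)))
  where
  off : ∀ a → a < suc n → a ≢ n ∸ k → when (k ≟ n ∸ a) (H a) ≡ + 0
  off a a<1+n a≢n∸k = when-no (k ≟ n ∸ a) (λ k≡n∸a →
    a≢n∸k (trans (sym (ℕP.m∸[m∸n]≡n (ℕP.≤-pred a<1+n))) (cong (n ∸_) (sym k≡n∸a))))
... | no k≰n = ∑-zero (suc n) (λ a _ → when-no (k ≟ n ∸ a) {H a} (λ k≡n∸a →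
                 k≰n (subst (_≤ n) (sym k≡n∸a) (ℕP.m∸n≤m n a))))

∑-divisible : ∀ j n (G : ℕ → ℕ → ℤ) →
              ∑[ a < suc n ] when ((n ∸ a) % suc j ≟ 0) (G a ((n ∸ a) / suc j)) ≡
              ∑[ r < suc n ] when (suc j ℕ.* r ≤? n) (G (n ∸ suc j ℕ.* r) r)
∑-divisible j n G = begin
  ∑[ a < suc n ] when ((n ∸ a) % suc j ≟ 0) (G a ((n ∸ a) / suc j))
    ≡⟨ ∑-cong (suc n) (λ a _ → sym (∑-multiples j (n ∸ a) (suc n) (G a) (s≤s (ℕP.m∸n≤m n a)))) ⟩
  ∑[ a < suc n ] ∑[ r < suc n ] when (suc j ℕ.* r ≟ n ∸ a) (G a r)
    ≡⟨ ∑-comm (suc n) (suc n) (λ a r → when (suc j ℕ.* r ≟ n ∸ a) (G a r)) ⟩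
  ∑[ r < suc n ] ∑[ a < suc n ] when (suc j ℕ.* r ≟ n ∸ a) (G a r)
    ≡⟨ ∑-cong (suc n) (λ r _ → ∑-complement n (suc j ℕ.* r) (λ a → G a r)) ⟩
  ∑[ r < suc n ] when (suc j ℕ.* r ≤? n) (G (n ∸ suc j ℕ.* r) r)
    ∎
  where open ≡-Reasoning

∑-restrict : ∀ n k (F : ℕ → ℤ) →
             ∑[ a < suc n ] when (k ≤? n ∸ a) (F a) ≡ when (k ≤? n) (∑[ a < suc (n ∸ k) ] F a)
∑-restrict n k F = ≡when (k ≤? n) restrict (λ k≰n → ∑-zero (suc n) (λ a _ →
                     when-no (k ≤? n ∸ a) {F a} (λ k≤n∸a → k≰n (ℕP.≤-trans k≤n∸a (ℕP.m∸n≤m n a)))))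
  where
  restrict : k ≤ n → ∑[ a < suc n ] when (k ≤? n ∸ a) (F a) ≡ ∑[ a < suc (n ∸ k) ] F a
  restrict k≤n = begin
    ∑[ a < suc n ] when (k ≤? n ∸ a) (F a)
      ≡⟨ ∑-extend (suc n) (λ a → when (k ≤? n ∸ a) (F a)) (s≤s (ℕP.m∸n≤m n k)) (λ a n∸k<a a<1+n →
           when-no (k ≤? n ∸ a) (ℕP.<⇒≱ n∸k<a ∘ ∸-≤-swap (ℕP.≤-pred a<1+n))) ⟩
    ∑[ a < suc (n ∸ k) ] when (k ≤? n ∸ a) (F a)
      ≡⟨ ∑-cong (suc (n ∸ k)) (λ a a<1+n∸k → when-yes (k ≤? n ∸ a) (∸-≤-swap k≤n (ℕP.≤-pred a<1+n∸k))) ⟩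
    ∑[ a < suc (n ∸ k) ] F a
      ∎
    where open ≡-Reasoning

windowSum : ℕ → (ℤ → ℤ) → ℤ
windowSum a h = ∑[ i < suc (a ℕ.+ a) ] h (+ i - + a)

·-unfold : ∀ f g n m → (f · g) n m ≡ ∑[ a < suc n ] windowSum a (λ b → f a b * g (n ∸ a) (m - b))
·-unfold f g n m =
  trans (cong sumℤ (ListP.map-cong sum-window (upTo (suc n))))
        (sum-upTo (λ a → windowSum a (λ b → f a b * g (n ∸ a) (m - b))) (suc n))
  where
  sum-window : ∀ a → sumℤ (map (λ b → f a b * g (n ∸ a) (m - b)) (window a))
                   ≡ windowSum a (λ b → f a b * g (n ∸ a) (m - b))
  sum-window a = trans (cong sumℤ (sym (ListP.map-∘ {g = λ b → f a b * g (n ∸ a) (m - b)} (upTo (suc (a ℕ.+ a))))))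
                       (sum-upTo (λ i → f a (+ i - + a) * g (n ∸ a) (m - (+ i - + a))) (suc (a ℕ.+ a)))

window-bound : ∀ a i → i < suc (a ℕ.+ a) → ∣ + i - + a ∣ ≤ a
window-bound a i i<1+2a rewrite ℤP.m-n≡m⊖n i a with ℕP.≤-total a i
... | inj₁ a≤i rewrite ℤP.⊖-≥ a≤i = ℕP.m≤n+o⇒m∸n≤o i a (ℕP.≤-pred i<1+2a)
... | inj₂ i≤a rewrite ℤP.⊖-≤ i≤a | ℤP.∣-i∣≡∣i∣ (+ (a ∸ i)) = ℕP.m∸n≤m a i

window-index : ∀ {a} v → ∣ v ∣ ≤ a → ∃ λ i → i < suc (a ℕ.+ a) × + i - + a ≡ v
window-index {a} (+ p) p≤a = p ℕ.+ a , s≤s (ℕP.+-monoˡ-≤ a p≤a) , shift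
  where
  shift : + (p ℕ.+ a) - + a ≡ + p
  shift rewrite ℤP.pos-+ p a = x+y-y≡x (+ p) (+ a)
    where
    x+y-y≡x : ∀ x y → x + y - y ≡ x
    x+y-y≡x = solve-∀
window-index {a} -[1+ p ] 1+p≤a = a ∸ suc p , s≤s (ℕP.≤-trans (ℕP.m∸n≤m a (suc p)) (ℕP.m≤m+n a a)) , shift
  where
  shift : + (a ∸ suc p) - + a ≡ -[1+ p ]
  shift rewrite sym (ℤP.⊖-≥ 1+p≤a) | sym (ℤP.m-n≡m⊖n a (suc p)) = x-y-x≡-y (+ a) (+ suc p)
    where
    x-y-x≡-y : ∀ x y → x - y - x ≡ - y
    x-y-x≡-y = solve-∀

window-delta : ∀ a v (h : ℤ → ℤ) → (∀ b → b ≢ v → h b ≡ + 0) → (a < ∣ v ∣ → h v ≡ + 0) →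
               windowSum a h ≡ h v
window-delta a v h h≡0 hv≡0 with a <? ∣ v ∣
... | yes a<∣v∣ = trans (∑-zero (suc (a ℕ.+ a)) (λ i _ → vanish (+ i - + a))) (sym (hv≡0 a<∣v∣))
  where
  vanish : ∀ b → h b ≡ + 0
  vanish b with b ≟ℤ v
  ... | yes refl = hv≡0 a<∣v∣
  ... | no b≢v   = h≡0 b b≢v
... | no a≮∣v∣ with window-index v (ℕP.≮⇒≥ a≮∣v∣)
... | i , i<1+2a , refl = ∑-delta (suc (a ℕ.+ a)) i i<1+2a (λ j _ j≢i → h≡0 _ (j≢i ∘ cancel))
  where
  cancel : ∀ {j} → + j - + a ≡ + i - + a → j ≡ i
  cancel {j} eq = ℤP.+-injective (begin
    + j              ≡⟨ x-y+y≡x (+ j) (+ a) ⟨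
    + j - + a + + a  ≡⟨ cong (λ x → x + + a) eq ⟩
    + i - + a + + a  ≡⟨ x-y+y≡x (+ i) (+ a) ⟩
    + i              ∎)
    where open ≡-Reasoning

infix 4 _≈_

_≈_ : Series → Series → Set
f ≈ g = ∀ n m → f n m ≡ g n m

Supported : Series → Set
Supported f = ∀ n m → n < ∣ m ∣ → f n m ≡ + 0

XFree : Series → Set
XFree f = ∀ n m → m ≢ + 0 → f n m ≡ + 0

Nonnegative : Series → Set
Nonnegative f = ∀ n m → + 0 ≤ℤ f n m

Symmetric : Series → Set
Symmetric f = ∀ n m → f n (- m) ≡ f n m

Decreasing₂ : Series → Set
Decreasing₂ f = ∀ n m → f n (+ m + + 2) ≤ℤ f n (+ m)

decreasing₂-resp-≈ : ∀ {f g} → f ≈ g → Decreasing₂ g → Decreasing₂ f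
decreasing₂-resp-≈ {f} {g} f≈g g-dec n m = subst₂ _≤ℤ_ (sym (f≈g n (+ m + + 2))) (sym (f≈g n (+ m))) (g-dec n m)

*-vanishʳ : ∀ x {y} → y ≡ + 0 → x * y ≡ + 0
*-vanishʳ x refl = ℤP.*-zeroʳ x

*-vanishˡ : ∀ {x} y → x ≡ + 0 → x * y ≡ + 0
*-vanishˡ y refl = refl

·-congʳ : ∀ f {g h} → g ≈ h → f · g ≈ f · h
·-congʳ f {g} {h} g≈h n m = begin
  (f · g) n m
    ≡⟨ ·-unfold f g n m ⟩
  ∑[ a < suc n ] windowSum a (λ b → f a b * g (n ∸ a) (m - b))
    ≡⟨ ∑-cong (suc n) (λ a _ → ∑-cong (suc (a ℕ.+ a)) (λ i _ →
         cong (f a (+ i - + a) *_) (g≈h (n ∸ a) (m - (+ i - + a))))) ⟩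
  ∑[ a < suc n ] windowSum a (λ b → f a b * h (n ∸ a) (m - b))
    ≡⟨ ·-unfold f h n m ⟨
  (f · h) n m
    ∎
  where open ≡-Reasoning

·-supported : ∀ f {g} → Supported g → Supported (f · g)
·-supported f {g} g-supp n m n<∣m∣ =
  trans (·-unfold f g n m)
        (∑-zero (suc n) (λ a a<1+n → ∑-zero (suc (a ℕ.+ a)) (λ i i<1+2a →
          *-vanishʳ (f a (+ i - + a)) (g-supp (n ∸ a) (m - (+ i - + a))
            (outside (ℕP.≤-pred a<1+n) (window-bound a i i<1+2a))))))
  where
  outside : ∀ {a b} → a ≤ n → ∣ b ∣ ≤ a → n ∸ a < ∣ m - b ∣
  outside {a} {b} a≤n ∣b∣≤a = ℕP.+-cancelʳ-< a (n ∸ a) ∣ m - b ∣ (begin-strict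
    n ∸ a ℕ.+ a            ≡⟨ ℕP.m∸n+n≡m a≤n ⟩
    n                      <⟨ n<∣m∣ ⟩
    ∣ m ∣                  ≡⟨ cong ∣_∣ (x-y+y≡x m b) ⟨
    ∣ m - b + b ∣          ≤⟨ ℤP.∣i+j∣≤∣i∣+∣j∣ (m - b) b ⟩
    ∣ m - b ∣ ℕ.+ ∣ b ∣    ≤⟨ ℕP.+-monoʳ-≤ ∣ m - b ∣ ∣b∣≤a ⟩
    ∣ m - b ∣ ℕ.+ a        ∎)
    where open ℕP.≤-Reasoning

·-xfree-unfold : ∀ {f} g → XFree f → ∀ n m → (f · g) n m ≡ ∑[ a < suc n ] (f a (+ 0) * g (n ∸ a) m)
·-xfree-unfold {f} g f-xfree n m = trans (·-unfold f g n m) (∑-cong (suc n) (λ a _ →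
  trans (window-delta a (+ 0) (λ b → f a b * g (n ∸ a) (m - b)) (λ b b≢0 → *-vanishˡ _ (f-xfree a b b≢0)) (λ ()))
        (cong (λ u → f a (+ 0) * g (n ∸ a) u) (ℤP.+-identityʳ m))))

·-xfree : ∀ f g → XFree f → XFree g → XFree (f · g)
·-xfree f g f-xfree g-xfree n m m≢0 =
  trans (·-xfree-unfold g f-xfree n m) (∑-zero (suc n) (λ a _ → *-vanishʳ (f a (+ 0)) (g-xfree (n ∸ a) m m≢0)))

*-nonneg : ∀ {x y} → + 0 ≤ℤ x → + 0 ≤ℤ y → + 0 ≤ℤ x * y
*-nonneg {+ a} {+ b} _ _ = subst (+ 0 ≤ℤ_) (ℤP.pos-* a b) (+≤+ z≤n)

·-nonneg : ∀ f g → Nonnegative f → Nonnegative g → Nonnegative (f · g)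
·-nonneg f g f≥0 g≥0 n m = subst (+ 0 ≤ℤ_) (sym (·-unfold f g n m))
  (∑-nonneg (suc n) (λ a → ∑-nonneg (suc (a ℕ.+ a)) (λ i → *-nonneg (f≥0 _ _) (g≥0 _ _))))

·-decreasing₂ : ∀ f g → XFree f → Nonnegative f → Decreasing₂ g → Decreasing₂ (f · g)
·-decreasing₂ f g f-xfree f≥0 g-dec n m = begin
  (f · g) n (+ m + + 2)
    ≡⟨ ·-xfree-unfold g f-xfree n (+ m + + 2) ⟩
  ∑[ a < suc n ] (f a (+ 0) * g (n ∸ a) (+ m + + 2))
    ≤⟨ ∑-mono-≤ (suc n) (λ a _ →
         ℤP.*-monoˡ-≤-nonNeg (f a (+ 0)) {{ℤ.nonNegative (f≥0 a (+ 0))}} (g-dec (n ∸ a) m)) ⟩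
  ∑[ a < suc n ] (f a (+ 0) * g (n ∸ a) (+ m))
    ≡⟨ ·-xfree-unfold g f-xfree n (+ m) ⟨
  (f · g) n (+ m)
    ∎
  where open ℤP.≤-Reasoning

indicator-nonneg : ∀ b → + 0 ≤ℤ (if b then + 1 else + 0)
indicator-nonneg true  = +≤+ z≤n
indicator-nonneg false = +≤+ z≤n

qpow-nonneg : ∀ s → Nonnegative (qpow s)
qpow-nonneg s n m = indicator-nonneg _

qpow-offˡ : ∀ s {n} m → n ≢ s → qpow s n m ≡ + 0
qpow-offˡ s {n} m n≢s with n ≟ s
... | yes n≡s = contradiction n≡s n≢s
... | no _    = refl

qpow-xfree : ∀ s → XFree (qpow s)
qpow-xfree s n m m≢0 with n ≟ s | m ≟ℤ + 0
... | yes _ | yes m≡0 = contradiction m≡0 m≢0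
... | yes _ | no _    = refl
... | no _  | _       = refl

qpow-supported : ∀ s → Supported (qpow s)
qpow-supported s n m n<∣m∣ = qpow-xfree s n m (λ { refl → ℕP.n≮0 n<∣m∣ })

qpow-symmetric : ∀ s → Symmetric (qpow s)
qpow-symmetric s n (+ 0)    = refl
qpow-symmetric s n +[1+ k ] = trans (qpow-xfree s n -[1+ k ] (λ ())) (sym (qpow-xfree s n +[1+ k ] (λ ())))
qpow-symmetric s n -[1+ k ] = trans (qpow-xfree s n +[1+ k ] (λ ())) (sym (qpow-xfree s n -[1+ k ] (λ ())))

qpow-decreasing₂ : ∀ s → Decreasing₂ (qpow s)
qpow-decreasing₂ s n m = subst (_≤ℤ qpow s n (+ m)) (sym (qpow-xfree s n (+ m + + 2) m+2≢0)) (qpow-nonneg s n (+ m))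
  where
  m+2≢0 : + m + + 2 ≢ + 0
  m+2≢0 eq with ℕP.m+n≡0⇒n≡0 m (ℤP.+-injective eq)
  ... | ()

invFactor-nonneg : ∀ e j → Nonnegative (invFactor e j)
invFactor-nonneg e j n m = indicator-nonneg _

invFactor-off-mod : ∀ e j n m → n % suc j ≢ 0 → invFactor e j n m ≡ + 0
invFactor-off-mod e j n m ¬c∣n with n % suc j ≟ 0
... | yes c∣n = contradiction c∣n ¬c∣n
... | no _    = refl

invFactor-off-exp : ∀ e j n {m} → m ≢ e * + (n / suc j) → invFactor e j n m ≡ + 0
invFactor-off-exp e j n {m} m≢ with n % suc j ≟ 0 | m ≟ℤ e * + (n / suc j)
... | yes _ | yes m≡ = contradiction m≡ m≢
... | yes _ | no _   = refl
... | no _  | _      = refl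

invFactor-on : ∀ e j n → n % suc j ≡ 0 → invFactor e j n (e * + (n / suc j)) ≡ + 1
invFactor-on e j n c∣n with n % suc j ≟ 0 | e * + (n / suc j) ≟ℤ e * + (n / suc j)
... | yes _ | yes _  = refl
... | yes _ | no ≢   = contradiction refl ≢
... | no ¬c∣n | _    = contradiction c∣n ¬c∣n

invFactor-supported : ∀ e j → ∣ e ∣ ≤ 1 → Supported (invFactor e j)
invFactor-supported e j ∣e∣≤1 n m n<∣m∣ = invFactor-off-exp e j n (λ { refl → ℕP.<⇒≱ n<∣m∣ ∣eq∣≤n })
  where
  ∣eq∣≤n : ∣ e * + (n / suc j) ∣ ≤ n
  ∣eq∣≤n = begin
    ∣ e * + (n / suc j) ∣      ≡⟨ ℤP.abs-* e (+ (n / suc j)) ⟩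
    ∣ e ∣ ℕ.* (n / suc j)      ≤⟨ ℕP.*-monoˡ-≤ (n / suc j) ∣e∣≤1 ⟩
    1 ℕ.* (n / suc j)          ≡⟨ ℕP.*-identityˡ (n / suc j) ⟩
    n / suc j                  ≤⟨ m/n≤m n (suc j) ⟩
    n                          ∎
    where open ℕP.≤-Reasoning

invPoch-supported : ∀ e j → ∣ e ∣ ≤ 1 → Supported (invPoch e j)
invPoch-supported e zero    _     = qpow-supported 0
invPoch-supported e (suc j) ∣e∣≤1 = ·-supported (invPoch e j) (invFactor-supported e j ∣e∣≤1)

invFactor-xfree : ∀ j → XFree (invFactor (+ 0) j)
invFactor-xfree j n m = invFactor-off-exp (+ 0) j n

invPoch-xfree : ∀ j → XFree (invPoch (+ 0) j)
invPoch-xfree zero    = qpow-xfree 0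
invPoch-xfree (suc j) = ·-xfree (invPoch (+ 0) j) (invFactor (+ 0) j) (invPoch-xfree j) (invFactor-xfree j)

invPoch-nonneg : ∀ e j → Nonnegative (invPoch e j)
invPoch-nonneg e zero    = qpow-nonneg 0
invPoch-nonneg e (suc j) = ·-nonneg (invPoch e j) (invFactor e j) (invPoch-nonneg e j) (invFactor-nonneg e j)

·-identityʳ : ∀ {f} → Supported f → f · one ≈ f
·-identityʳ {f} f-supp n m = begin
  (f · one) n m
    ≡⟨ ·-unfold f one n m ⟩
  ∑[ a < suc n ] windowSum a (λ b → f a b * one (n ∸ a) (m - b))
    ≡⟨ ∑-delta (suc n) n ℕP.≤-refl off-diagonal ⟩
  windowSum n (λ b → f n b * one (n ∸ n) (m - b))
    ≡⟨ window-delta n m (λ b → f n b * one (n ∸ n) (m - b)) off-exponent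
                        (*-vanishˡ (one (n ∸ n) (m - m)) ∘ f-supp n m) ⟩
  f n m * one (n ∸ n) (m - m)
    ≡⟨ cong₂ (λ d u → f n m * one d u) (ℕP.n∸n≡0 n) (ℤP.+-inverseʳ m) ⟩
  f n m * + 1
    ≡⟨ ℤP.*-identityʳ (f n m) ⟩
  f n m
    ∎
  where
  open ≡-Reasoning
  off-diagonal : ∀ a → a < suc n → a ≢ n → windowSum a (λ b → f a b * one (n ∸ a) (m - b)) ≡ + 0
  off-diagonal a a<1+n a≢n = ∑-zero (suc (a ℕ.+ a)) (λ i _ → *-vanishʳ (f a (+ i - + a))
    (qpow-offˡ 0 (m - (+ i - + a)) (a≢n ∘ ℕP.≤-antisym (ℕP.≤-pred a<1+n) ∘ ℕP.m∸n≡0⇒m≤n)))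
  off-exponent : ∀ b → b ≢ m → f n b * one (n ∸ n) (m - b) ≡ + 0
  off-exponent b b≢m = *-vanishʳ (f n b) (qpow-xfree 0 (n ∸ n) (m - b) (b≢m ∘ sym ∘ x-y≡0⇒x≡y m b))
    where
    x-y≡0⇒x≡y : ∀ x y → x - y ≡ + 0 → x ≡ y
    x-y≡0⇒x≡y x y eq = trans (sym (x-y+y≡x x y)) (trans (cong (_+ y) eq) (ℤP.+-identityˡ y))

geoSum : ℤ → ℕ → Series → Series
geoSum e j f n m = ∑[ r < suc n ] when (suc j ℕ.* r ≤? n) (f (n ∸ suc j ℕ.* r) (m - e * + r))

geoSum-extend : ∀ e j f {n} N m → n < N →
                geoSum e j f n m ≡ ∑[ r < N ] when (suc j ℕ.* r ≤? n) (f (n ∸ suc j ℕ.* r) (m - e * + r))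
geoSum-extend e j f {n} N m n<N =
  sym (∑-extend N (λ r → when (suc j ℕ.* r ≤? n) (f (n ∸ suc j ℕ.* r) (m - e * + r))) n<N
         (λ r n<r _ → when-no (suc j ℕ.* r ≤? n) (ℕP.<⇒≱ n<r ∘ ℕP.≤-trans (ℕP.m≤n*m r (suc j)))))

geoSum-cong : ∀ e j {f g} → f ≈ g → geoSum e j f ≈ geoSum e j g
geoSum-cong e j {f} {g} f≈g n m = ∑-cong (suc n) (λ r _ →
  when-cong (suc j ℕ.* r ≤? n) (λ _ → f≈g (n ∸ suc j ℕ.* r) (m - e * + r)))

invFactor-window : ∀ e j {f} → Supported f → ∀ n m a →
                   windowSum a (λ b → f a b * invFactor e j (n ∸ a) (m - b)) ≡
                   when ((n ∸ a) % suc j ≟ 0) (f a (m - e * + ((n ∸ a) / suc j)))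
invFactor-window e j {f} f-supp n m a = ≡when ((n ∸ a) % suc j ≟ 0) divisible indivisible
  where
  q : ℕ
  q = (n ∸ a) / suc j
  v : ℤ
  v = m - e * + q
  x-[x-y]≡y : ∀ x y → x - (x - y) ≡ y
  x-[x-y]≡y = solve-∀
  indivisible : (n ∸ a) % suc j ≢ 0 → windowSum a (λ b → f a b * invFactor e j (n ∸ a) (m - b)) ≡ + 0
  indivisible c∤n-a = ∑-zero (suc (a ℕ.+ a)) (λ i _ →
    *-vanishʳ (f a (+ i - + a)) (invFactor-off-mod e j (n ∸ a) (m - (+ i - + a)) c∤n-a))
  off : ∀ b → b ≢ v → f a b * invFactor e j (n ∸ a) (m - b) ≡ + 0
  off b b≢v = *-vanishʳ (f a b) (invFactor-off-exp e j (n ∸ a) (λ m-b≡eq →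
    b≢v (trans (sym (x-[x-y]≡y m b)) (cong (_-_ m) m-b≡eq))))
  divisible : (n ∸ a) % suc j ≡ 0 → windowSum a (λ b → f a b * invFactor e j (n ∸ a) (m - b)) ≡ f a v
  divisible c∣n-a = begin
    windowSum a (λ b → f a b * invFactor e j (n ∸ a) (m - b))
      ≡⟨ window-delta a v (λ b → f a b * invFactor e j (n ∸ a) (m - b)) off (*-vanishˡ _ ∘ f-supp a v) ⟩
    f a v * invFactor e j (n ∸ a) (m - v)
      ≡⟨ cong (λ u → f a v * invFactor e j (n ∸ a) u) (x-[x-y]≡y m (e * + q)) ⟩
    f a v * invFactor e j (n ∸ a) (e * + q)
      ≡⟨ cong (f a v *_) (invFactor-on e j (n ∸ a) c∣n-a) ⟩
    f a v * + 1
      ≡⟨ ℤP.*-identityʳ (f a v) ⟩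
    f a v
      ∎
    where open ≡-Reasoning

·-invFactor : ∀ e j {f} → Supported f → f · invFactor e j ≈ geoSum e j f
·-invFactor e j {f} f-supp n m = begin
  (f · invFactor e j) n m
    ≡⟨ ·-unfold f (invFactor e j) n m ⟩
  ∑[ a < suc n ] windowSum a (λ b → f a b * invFactor e j (n ∸ a) (m - b))
    ≡⟨ ∑-cong (suc n) (λ a _ → invFactor-window e j f-supp n m a) ⟩
  ∑[ a < suc n ] when ((n ∸ a) % suc j ≟ 0) (f a (m - e * + ((n ∸ a) / suc j)))
    ≡⟨ ∑-divisible j n (λ a r → f a (m - e * + r)) ⟩
  geoSum e j f n m
    ∎
  where open ≡-Reasoning

·-geoSum : ∀ e j f g → f · geoSum e j g ≈ geoSum e j (f · g)
·-geoSum e j f g n m = begin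
  (f · geoSum e j g) n m
    ≡⟨ ·-unfold f (geoSum e j g) n m ⟩
  ∑[ a < suc n ] windowSum a (λ b → f a b * geoSum e j g (n ∸ a) (m - b))
    ≡⟨ ∑-cong (suc n) (λ a _ → expand a) ⟩
  ∑[ a < suc n ] ∑[ r < suc n ] when (c r ≤? n ∸ a) (V a r)
    ≡⟨ ∑-comm (suc n) (suc n) (λ a r → when (c r ≤? n ∸ a) (V a r)) ⟩
  ∑[ r < suc n ] ∑[ a < suc n ] when (c r ≤? n ∸ a) (V a r)
    ≡⟨ ∑-cong (suc n) (λ r _ → trans (∑-restrict n (c r) (λ a → V a r))
                                     (when-cong (c r ≤? n) (λ _ → sym (·-unfold-shifted r)))) ⟩
  geoSum e j (f · g) n m
    ∎
  where
  open ≡-Reasoning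
  c : ℕ → ℕ
  c r = suc j ℕ.* r
  V : ℕ → ℕ → ℤ
  V a r = windowSum a (λ b → f a b * g (n ∸ a ∸ c r) (m - b - e * + r))
  expand : ∀ a → windowSum a (λ b → f a b * geoSum e j g (n ∸ a) (m - b)) ≡
                 ∑[ r < suc n ] when (c r ≤? n ∸ a) (V a r)
  expand a = begin
    windowSum a (λ b → f a b * geoSum e j g (n ∸ a) (m - b))
      ≡⟨ ∑-cong (suc (a ℕ.+ a)) (λ i _ → trans
           (cong (f a (+ i - + a) *_) (geoSum-extend e j g (suc n) (m - (+ i - + a)) (s≤s (ℕP.m∸n≤m n a))))
           (trans (*-distribˡ-∑ (suc n) (f a (+ i - + a)) _)
                  (∑-cong (suc n) (λ r _ → *-when (c r ≤? n ∸ a) (f a (+ i - + a)) _)))) ⟩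
    windowSum a (λ b → ∑[ r < suc n ] when (c r ≤? n ∸ a) (f a b * g (n ∸ a ∸ c r) (m - b - e * + r)))
      ≡⟨ ∑-comm (suc (a ℕ.+ a)) (suc n) (λ i r →
           when (c r ≤? n ∸ a) (f a (+ i - + a) * g (n ∸ a ∸ c r) (m - (+ i - + a) - e * + r))) ⟩
    ∑[ r < suc n ] windowSum a (λ b → when (c r ≤? n ∸ a) (f a b * g (n ∸ a ∸ c r) (m - b - e * + r)))
      ≡⟨ ∑-cong (suc n) (λ r _ → ∑-when (c r ≤? n ∸ a) (suc (a ℕ.+ a)) (λ i →
           f a (+ i - + a) * g (n ∸ a ∸ c r) (m - (+ i - + a) - e * + r))) ⟩
    ∑[ r < suc n ] when (c r ≤? n ∸ a) (V a r)
      ∎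
  ·-unfold-shifted : ∀ r → (f · g) (n ∸ c r) (m - e * + r) ≡ ∑[ a < suc (n ∸ c r) ] V a r
  ·-unfold-shifted r = trans (·-unfold f g (n ∸ c r) (m - e * + r))
    (∑-cong (suc (n ∸ c r)) (λ a _ → ∑-cong (suc (a ℕ.+ a)) (λ i _ →
      cong₂ (λ k u → f a (+ i - + a) * g k u) (∸-swap n (c r) a) (x-y-z≡x-z-y m (e * + r) (+ i - + a)))))

geoSum² : ∀ e j e′ j′ f {n} N M m → n < N → n < M →
          geoSum e j (geoSum e′ j′ f) n m ≡
          ∑[ s < N ] ∑[ r < M ] when (suc j ℕ.* s ℕ.+ suc j′ ℕ.* r ≤? n)
                                     (f (n ∸ (suc j ℕ.* s ℕ.+ suc j′ ℕ.* r)) (m - e * + s - e′ * + r))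
geoSum² e j e′ j′ f {n} N M m n<N n<M =
  trans (geoSum-extend e j (geoSum e′ j′ f) N m n<N) (∑-cong N (λ s _ → begin
    when (c s ≤? n) (geoSum e′ j′ f (n ∸ c s) (m - e * + s))
      ≡⟨ when-cong (c s ≤? n) (λ _ → geoSum-extend e′ j′ f M (m - e * + s) (ℕP.≤-<-trans (ℕP.m∸n≤m n (c s)) n<M)) ⟩
    when (c s ≤? n) (∑[ r < M ] when (c′ r ≤? n ∸ c s) (f (n ∸ c s ∸ c′ r) (m - e * + s - e′ * + r)))
      ≡⟨ ∑-when (c s ≤? n) M _ ⟨
    ∑[ r < M ] when (c s ≤? n) (when (c′ r ≤? n ∸ c s) (f (n ∸ c s ∸ c′ r) (m - e * + s - e′ * + r)))
      ≡⟨ ∑-cong M (λ r _ → trans (when-≤-∸ (c s) (c′ r) n _) (when-cong (c s ℕ.+ c′ r ≤? n) (λ _ →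
           cong (λ k → f k (m - e * + s - e′ * + r)) (ℕP.∸-+-assoc n (c s) (c′ r))))) ⟩
    ∑[ r < M ] when (c s ℕ.+ c′ r ≤? n) (f (n ∸ (c s ℕ.+ c′ r)) (m - e * + s - e′ * + r))
      ∎))
  where
  open ≡-Reasoning
  c c′ : ℕ → ℕ
  c s = suc j ℕ.* s
  c′ r = suc j′ ℕ.* r

geoSum-comm : ∀ e j e′ j′ f → geoSum e j (geoSum e′ j′ f) ≈ geoSum e′ j′ (geoSum e j f)
geoSum-comm e j e′ j′ f n m = begin
  geoSum e j (geoSum e′ j′ f) n m
    ≡⟨ geoSum² e j e′ j′ f (suc n) (suc n) m ℕP.≤-refl ℕP.≤-refl ⟩
  ∑[ s < suc n ] ∑[ r < suc n ] T s r
    ≡⟨ ∑-comm (suc n) (suc n) T ⟩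
  ∑[ r < suc n ] ∑[ s < suc n ] T s r
    ≡⟨ ∑-cong (suc n) (λ r _ → ∑-cong (suc n) (λ s _ → swap s r)) ⟩
  ∑[ r < suc n ] ∑[ s < suc n ] when (suc j′ ℕ.* r ℕ.+ suc j ℕ.* s ≤? n)
                                     (f (n ∸ (suc j′ ℕ.* r ℕ.+ suc j ℕ.* s)) (m - e′ * + r - e * + s))
    ≡⟨ geoSum² e′ j′ e j f (suc n) (suc n) m ℕP.≤-refl ℕP.≤-refl ⟨
  geoSum e′ j′ (geoSum e j f) n m
    ∎
  where
  open ≡-Reasoning
  T : ℕ → ℕ → ℤ
  T s r = when (suc j ℕ.* s ℕ.+ suc j′ ℕ.* r ≤? n) (f (n ∸ (suc j ℕ.* s ℕ.+ suc j′ ℕ.* r)) (m - e * + s - e′ * + r))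
  swap : ∀ s r → T s r ≡ when (suc j′ ℕ.* r ℕ.+ suc j ℕ.* s ≤? n)
                              (f (n ∸ (suc j′ ℕ.* r ℕ.+ suc j ℕ.* s)) (m - e′ * + r - e * + s))
  swap s r rewrite ℕP.+-comm (suc j ℕ.* s) (suc j′ ℕ.* r) =
    when-cong (suc j′ ℕ.* r ℕ.+ suc j ℕ.* s ≤? n) (λ _ → cong (f _) (x-y-z≡x-z-y m (e * + s) (e′ * + r)))

geoSums : ℤ → ℕ → Series → Series
geoSums e zero    f = f
geoSums e (suc a) f = geoSum e a (geoSums e a f)

geoSums-cong : ∀ e a {f g} → f ≈ g → geoSums e a f ≈ geoSums e a g
geoSums-cong e zero    f≈g = f≈g
geoSums-cong e (suc a) f≈g = geoSum-cong e a (geoSums-cong e a f≈g)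

·-invPoch : ∀ e a {f} → ∣ e ∣ ≤ 1 → Supported f → f · invPoch e a ≈ geoSums e a f
·-invPoch e zero    ∣e∣≤1 f-supp = ·-identityʳ f-supp
·-invPoch e (suc a) {f} ∣e∣≤1 f-supp n m = begin
  (f · (invPoch e a · invFactor e a)) n m  ≡⟨ ·-congʳ f (·-invFactor e a (invPoch-supported e a ∣e∣≤1)) n m ⟩
  (f · geoSum e a (invPoch e a)) n m       ≡⟨ ·-geoSum e a f (invPoch e a) n m ⟩
  geoSum e a (f · invPoch e a) n m         ≡⟨ geoSum-cong e a (·-invPoch e a ∣e∣≤1 f-supp) n m ⟩
  geoSums e (suc a) f n m                  ∎
  where open ≡-Reasoning

geoSums-geoSum : ∀ e′ a e j f → geoSums e′ a (geoSum e j f) ≈ geoSum e j (geoSums e′ a f)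
geoSums-geoSum e′ zero    e j f n m = refl
geoSums-geoSum e′ (suc a) e j f n m =
  trans (geoSum-cong e′ a (geoSums-geoSum e′ a e j f) n m) (geoSum-comm e′ a e j (geoSums e′ a f) n m)

symGeo : ℕ → Series → Series
symGeo j f = geoSum (- + 1) j (geoSum (+ 1) j f)

symGeos : ℕ → Series → Series
symGeos zero    f = f
symGeos (suc a) f = symGeo a (symGeos a f)

geoSums-interleave : ∀ a f → geoSums (- + 1) a (geoSums (+ 1) a f) ≈ symGeos a f
geoSums-interleave zero    f n m = refl
geoSums-interleave (suc a) f n m =
  trans (geoSum-cong (- + 1) a (geoSums-geoSum (- + 1) a (+ 1) a (geoSums (+ 1) a f)) n m)
        (geoSum-cong (- + 1) a (geoSum-cong (+ 1) a (geoSums-interleave a f)) n m)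

single-chain : ∀ a → term (a ∷ []) ≈ symGeos a (qpow (a ℕ.* a))
single-chain a n m = begin
  (qpow (a ℕ.* a) · invPoch (+ 1) a · invPoch (- + 1) a) n m
    ≡⟨ ·-invPoch (- + 1) a ℕP.≤-refl (·-supported (qpow (a ℕ.* a)) (invPoch-supported (+ 1) a ℕP.≤-refl)) n m ⟩
  geoSums (- + 1) a (qpow (a ℕ.* a) · invPoch (+ 1) a) n m
    ≡⟨ geoSums-cong (- + 1) a (·-invPoch (+ 1) a ℕP.≤-refl (qpow-supported (a ℕ.* a))) n m ⟩
  geoSums (- + 1) a (geoSums (+ 1) a (qpow (a ℕ.* a))) n m
    ≡⟨ geoSums-interleave a (qpow (a ℕ.* a)) n m ⟩
  symGeos a (qpow (a ℕ.* a)) n m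
    ∎
  where open ≡-Reasoning

module _ (f : ℤ → ℤ) (f-sym : ∀ m → f (- m) ≡ f m) (f-dec : ∀ m → f (+ m + + 2) ≤ℤ f (+ m)) where

  private
    f-dec-nonneg : ∀ {v} → + 0 ≤ℤ v → f (v + + 2) ≤ℤ f v
    f-dec-nonneg {+ m} _ = f-dec m

    f-dec-iter : ∀ k {v} → + 0 ≤ℤ v → f (v + + 2 * + k) ≤ℤ f v
    f-dec-iter zero    {v} _   = ℤP.≤-reflexive (cong f (x+2*0≡x v))
      where
      x+2*0≡x : ∀ x → x + + 2 * + 0 ≡ x
      x+2*0≡x = solve-∀
    f-dec-iter (suc k) {v} 0≤v = begin
      f (v + + 2 * (+ 1 + + k))  ≡⟨ cong f (regroup v (+ k)) ⟩
      f (v + + 2 + + 2 * + k)    ≤⟨ f-dec-iter k (ℤP.+-mono-≤ 0≤v (+≤+ z≤n)) ⟩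
      f (v + + 2)                ≤⟨ f-dec-nonneg 0≤v ⟩
      f v                        ∎
      where
      open ℤP.≤-Reasoning
      regroup : ∀ x k → x + + 2 * (+ 1 + k) ≡ x + + 2 + + 2 * k
      regroup = solve-∀

  outer≤inner : ∀ m t → f (+ m + + 2 + + t) ≤ℤ f (+ m - + t)
  outer≤inner m t with ℕP.≤-total t m
  ... | inj₁ t≤m = begin
    f (+ m + + 2 + + t)                     ≡⟨ cong f (regroup (+ m) (+ t)) ⟩
    f (+ m - + t + + 2 * (+ 1 + + t))       ≤⟨ f-dec-iter (suc t) (ℤP.i≤j⇒0≤j-i (+≤+ t≤m)) ⟩
    f (+ m - + t)                           ∎
    where
    open ℤP.≤-Reasoning
    regroup : ∀ x y → x + + 2 + y ≡ x - y + + 2 * (+ 1 + y)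
    regroup = solve-∀
  ... | inj₂ m≤t = begin
    f (+ m + + 2 + + t)                     ≡⟨ cong f (regroup (+ m) (+ t)) ⟩
    f (+ t - + m + + 2 * (+ 1 + + m))       ≤⟨ f-dec-iter (suc m) (ℤP.i≤j⇒0≤j-i (+≤+ m≤t)) ⟩
    f (+ t - + m)                           ≡⟨ f-sym (+ t - + m) ⟨
    f (- (+ t - + m))                       ≡⟨ cong f (negate (+ m) (+ t)) ⟩
    f (+ m - + t)                           ∎
    where
    open ℤP.≤-Reasoning
    regroup : ∀ x y → x + + 2 + y ≡ y - x + + 2 * (+ 1 + x)
    regroup = solve-∀
    negate : ∀ x y → - (y - x) ≡ x - y
    negate = solve-∀

symGeoTerm : ℕ → Series → ℕ → ℤ → ℕ → ℕ → ℤ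
symGeoTerm j f n m s r =
  when (suc j ℕ.* s ℕ.+ suc j ℕ.* r ≤? n) (f (n ∸ (suc j ℕ.* s ℕ.+ suc j ℕ.* r)) (m + + s - + r))

symGeo-expand : ∀ j f {n} N M m → n < N → n < M →
                symGeo j f n m ≡ ∑[ s < N ] ∑[ r < M ] symGeoTerm j f n m s r
symGeo-expand j f {n} N M m n<N n<M =
  trans (geoSum² (- + 1) j (+ 1) j f N M m n<N n<M) (∑-cong N (λ s _ → ∑-cong M (λ r _ →
    when-cong (suc j ℕ.* s ℕ.+ suc j ℕ.* r ≤? n) (λ _ → cong (f _) (simplify m (+ s) (+ r))))))
  where
  simplify : ∀ m s r → m - (- + 1) * s - + 1 * r ≡ m + s - r
  simplify = solve-∀

symGeo-symmetric : ∀ j {f} → Symmetric f → Symmetric (symGeo j f)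
symGeo-symmetric j {f} f-sym n m = begin
  symGeo j f n (- m)
    ≡⟨ symGeo-expand j f (suc n) (suc n) (- m) ℕP.≤-refl ℕP.≤-refl ⟩
  ∑[ s < suc n ] ∑[ r < suc n ] symGeoTerm j f n (- m) s r
    ≡⟨ ∑-cong (suc n) (λ s _ → ∑-cong (suc n) (λ r _ → mirror s r)) ⟩
  ∑[ s < suc n ] ∑[ r < suc n ] symGeoTerm j f n m r s
    ≡⟨ ∑-comm (suc n) (suc n) (λ s r → symGeoTerm j f n m r s) ⟩
  ∑[ r < suc n ] ∑[ s < suc n ] symGeoTerm j f n m r s
    ≡⟨ symGeo-expand j f (suc n) (suc n) m ℕP.≤-refl ℕP.≤-refl ⟨
  symGeo j f n m
    ∎
  where
  open ≡-Reasoning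
  negate : ∀ m s r → - m + s - r ≡ - (m + r - s)
  negate = solve-∀
  mirror : ∀ s r → symGeoTerm j f n (- m) s r ≡ symGeoTerm j f n m r s
  mirror s r rewrite ℕP.+-comm (suc j ℕ.* s) (suc j ℕ.* r) =
    when-cong (suc j ℕ.* r ℕ.+ suc j ℕ.* s ≤? n) (λ _ →
      trans (cong (f _) (negate m (+ s) (+ r))) (f-sym _ (m + + r - + s)))

-- Peel off r = 0 from the sum for x^(m+2) and s = 0 from the sum for x^m; the remaining double
-- sums agree after (s, r + 1) ↦ (s + 1, r), and the peeled-off terms are compared by outer≤inner.
symGeo-decreasing₂ : ∀ j {f} → Symmetric f → Decreasing₂ f → Decreasing₂ (symGeo j f)
symGeo-decreasing₂ j {f} f-sym f-dec n m = begin
  symGeo j f n (+ m + + 2)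
    ≡⟨ symGeo-expand j f (suc n) (suc (suc n)) (+ m + + 2) ℕP.≤-refl (ℕP.m≤n⇒m≤1+n ℕP.≤-refl) ⟩
  ∑[ s < suc n ] ∑[ r < suc (suc n) ] T (+ m + + 2) s r
    ≡⟨ ∑-cong (suc n) (λ s _ → ∑-suc (suc n) (T (+ m + + 2) s)) ⟩
  ∑[ s < suc n ] (T (+ m + + 2) s 0 + ∑[ r < suc n ] T (+ m + + 2) s (suc r))
    ≡⟨ ∑-distrib-+ (suc n) (λ s → T (+ m + + 2) s 0) (λ s → ∑[ r < suc n ] T (+ m + + 2) s (suc r)) ⟩
  ∑[ s < suc n ] T (+ m + + 2) s 0 + ∑[ s < suc n ] ∑[ r < suc n ] T (+ m + + 2) s (suc r)
    ≡⟨ cong (_+_ (∑[ s < suc n ] T (+ m + + 2) s 0))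
            (∑-cong (suc n) (λ s _ → ∑-cong (suc n) (λ r _ → shift s r))) ⟩
  ∑[ s < suc n ] T (+ m + + 2) s 0 + ∑[ s < suc n ] ∑[ r < suc n ] T (+ m) (suc s) r
    ≤⟨ ℤP.+-monoˡ-≤ (∑[ s < suc n ] ∑[ r < suc n ] T (+ m) (suc s) r)
                    (∑-mono-≤ (suc n) (λ t _ → spread t)) ⟩
  ∑[ r < suc n ] T (+ m) 0 r + ∑[ s < suc n ] ∑[ r < suc n ] T (+ m) (suc s) r
    ≡⟨ ∑-suc (suc n) (λ s → ∑[ r < suc n ] T (+ m) s r) ⟨
  ∑[ s < suc (suc n) ] ∑[ r < suc n ] T (+ m) s r
    ≡⟨ symGeo-expand j f (suc (suc n)) (suc n) (+ m) (ℕP.m≤n⇒m≤1+n ℕP.≤-refl) ℕP.≤-refl ⟨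
  symGeo j f n (+ m)
    ∎
  where
  open ℤP.≤-Reasoning
  T : ℤ → ℕ → ℕ → ℤ
  T = symGeoTerm j f n
  c : ℕ → ℕ
  c s = suc j ℕ.* s
  swap-step : ∀ j s r → suc j ℕ.* s ℕ.+ suc j ℕ.* suc r ≡ suc j ℕ.* suc s ℕ.+ suc j ℕ.* r
  swap-step = ℕ-Ring.solve-∀
  rebalance : ∀ m s r → m + + 2 + s - (+ 1 + r) ≡ m + (+ 1 + s) - r
  rebalance = solve-∀
  shift : ∀ s r → T (+ m + + 2) s (suc r) ≡ T (+ m) (suc s) r
  shift s r rewrite swap-step j s r =
    when-cong (c (suc s) ℕ.+ c r ≤? n) (λ _ → cong (f _) (rebalance (+ m) (+ s) (+ r)))
  spread : ∀ t → T (+ m + + 2) t 0 ≤ℤ T (+ m) 0 t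
  spread t rewrite ℕP.*-zeroʳ (suc j) | ℕP.+-identityʳ (c t) = when-mono-≤ (c t ≤? n) (λ _ → begin
    f (n ∸ c t) (+ m + + 2 + + t - + 0)  ≡⟨ cong (f (n ∸ c t)) (ℤP.+-identityʳ (+ m + + 2 + + t)) ⟩
    f (n ∸ c t) (+ m + + 2 + + t)        ≤⟨ outer≤inner (f (n ∸ c t)) (f-sym (n ∸ c t)) (f-dec (n ∸ c t)) m t ⟩
    f (n ∸ c t) (+ m - + t)              ≡⟨ cong (λ u → f (n ∸ c t) (u - + t)) (ℤP.+-identityʳ (+ m)) ⟨
    f (n ∸ c t) (+ m + + 0 - + t)        ∎)

symGeos-invariant : ∀ a {f} → Symmetric f → Decreasing₂ f →
                    Symmetric (symGeos a f) × Decreasing₂ (symGeos a f)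
symGeos-invariant zero    f-sym f-dec = f-sym , f-dec
symGeos-invariant (suc a) f-sym f-dec with symGeos-invariant a f-sym f-dec
... | g-sym , g-dec = symGeo-symmetric a g-sym , symGeo-decreasing₂ a g-sym g-dec

term-decreasing₂ : ∀ ns → Decreasing₂ (term ns)
term-decreasing₂ []           = qpow-decreasing₂ 0
term-decreasing₂ (a ∷ [])     = decreasing₂-resp-≈ (single-chain a)
  (proj₂ (symGeos-invariant a (qpow-symmetric (a ℕ.* a)) (qpow-decreasing₂ (a ℕ.* a))))
term-decreasing₂ (a ∷ b ∷ ns) = ·-decreasing₂ prefactor (term (b ∷ ns))
  (·-xfree (qpow (a ℕ.* a)) (invPoch (+ 0) (a ∸ b)) (qpow-xfree (a ℕ.* a)) (invPoch-xfree (a ∸ b)))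
  (·-nonneg (qpow (a ℕ.* a)) (invPoch (+ 0) (a ∸ b)) (qpow-nonneg (a ℕ.* a)) (invPoch-nonneg (+ 0) (a ∸ b)))
  (term-decreasing₂ (b ∷ ns))
  where
  prefactor : Series
  prefactor = qpow (a ℕ.* a) · invPoch (+ 0) (a ∸ b)

sumℤ-mono-≤ : ∀ {A : Set} {f g : A → ℤ} → (∀ x → f x ≤ℤ g x) →
              ∀ xs → sumℤ (map f xs) ≤ℤ sumℤ (map g xs)
sumℤ-mono-≤ f≤g []       = ℤP.≤-refl
sumℤ-mono-≤ f≤g (x ∷ xs) = ℤP.+-mono-≤ (f≤g x) (sumℤ-mono-≤ f≤g xs)

theorem4p1 : (k m n : ℕ) → k ≥ 2 → N k (+ m) n ≥ℤ N k (+ m + + 2) n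
theorem4p1 k m n _ = sumℤ-mono-≤ (λ ns → term-decreasing₂ ns n m) (chains (k ∸ 1) n)
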